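{- There is a sequence $(H_n)_{n\in\mathbb{N}}$ of finite Heyting algebras such that for every $n$, $$1 > \mathrm{ds}_{H_n}(a\to b = \neg a \vee b) \geq 1 - \left(\tfrac{3}{4}\right)^{n+1}.$$
   Context: $\neg a$ abbreviates $a\to\bot$. For a finite Heyting algebra $H$, $\mathrm{ds}_H(a\to b=\neg a\vee b) = |\{(a,b)\in H^2 : a\to b = \neg a\vee b\}|/|H|^2$. -}

module Defs where

open import Level using (0ℓ)
open import Data.Nat as ℕ using (ℕ; suc; NonZero)
open import Data.Fin using (Fin; zero; suc)
open import Data.Fin.Properties using (_≟_)
open import Data.List using (List; length; filter; cartesianProduct; allFin)
open import Data.Product using (_×_; _,_)
open import Data.Integer using (+_)
open import Data.Rational using (ℚ; _/_)
import Data.Rational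
open import Relation.Binary.Core using (Rel)
open import Relation.Binary.PropositionalEquality using (_≡_)
open import Relation.Binary.Lattice.Structures using (IsHeytingAlgebra)

-- A finite Heyting algebra, presented (up to isomorphism) on the carrier
-- Fin size with propositional equality as the underlying equality.
record FiniteHeytingAlgebra : Set₁ where
  field
    size : ℕ
    _≤_  : Rel (Fin size) 0ℓ
    _∨_  : Fin size → Fin size → Fin size
    _∧_  : Fin size → Fin size → Fin size
    _⇨_  : Fin size → Fin size → Fin size
    ⊤    : Fin size
    ⊥    : Fin size
    isHeytingAlgebra : IsHeytingAlgebra _≡_ _≤_ _∨_ _∧_ _⇨_ ⊤ ⊥

  ¬_ : Fin size → Fin size
  ¬ a = a ⇨ ⊥

square-nonzero : ∀ {k} → Fin k → NonZero (k ℕ.* k)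
square-nonzero {suc k} _ = _

module _ (H : FiniteHeytingAlgebra) where
  open FiniteHeytingAlgebra H

  satisfyingPairs : List (Fin size × Fin size)
  satisfyingPairs =
    filter (λ p → let (a , b) = p in (a ⇨ b) ≟ ((¬ a) ∨ b))
           (cartesianProduct (allFin size) (allFin size))

  ds-impl-negor : ℚ
  ds-impl-negor = (+ length satisfyingPairs / (size ℕ.* size)) {{square-nonzero ⊤}}

infixr 8 _^ℚ_
_^ℚ_ : ℚ → ℕ → ℚ
q ^ℚ ℕ.zero  = Data.Rational.1ℚ
q ^ℚ suc n   = q Data.Rational.* (q ^ℚ n)

-- Adjoin a new top ⊤⁺ to the Boolean algebra 2ᵏ. For a ≰ b the implication of
-- 2ᵏ ⊕ 1 is still the Boolean one, ¬a ∨ b; but for a ≤ b inside 2ᵏ it jumps to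
-- ⊤⁺, while ¬a ∨ b stays inside 2ᵏ unless a = ⊥. So a → b = ¬a ∨ b can only fail
-- at the 3ᵏ comparable pairs of 2ᵏ, out of (2ᵏ + 1)² ≥ 4ᵏ pairs, and it does fail
-- at (⊤, ⊤) as soon as k ≥ 1.
module Submission where

open import Level using (0ℓ; _⊔_)
open import Algebra.Core using (Op₂)
open import Data.Bool as Bool using (Bool; true; false; not; _∨_; _∧_; if_then_else_; b≤b)
import Data.Bool.Properties as Bool
open import Data.Fin using (Fin; zero; suc; _↑ˡ_; _↑ʳ_; combine; remQuot)
open import Data.Fin.Properties using (_≟_; 2↔Bool; remQuot-combine; combine-remQuot)
open import Data.Integer using (+_; +≤+; +<+)
import Data.Integer as ℤ
import Data.Integer.Properties as ℤ
open import Data.List using (List; []; _∷_; _++_; length; filter; cartesianProduct; tabulate; allFin; map)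
open import Data.List.Properties using (filter-++; filter-notAll; length-++; length-map; length-tabulate; map-tabulate)
open import Data.List.Membership.Propositional using (lose)
open import Data.List.Membership.Propositional.Properties using (∈-cartesianProduct⁺; ∈-allFin)
open import Data.Nat as ℕ using (ℕ; zero; suc; _+_; _*_; _^_; z≤n; s≤s)
import Data.Nat.Properties as ℕ
open import Data.Nat.Tactic.RingSolver using (solve-∀)
open import Data.Product using (Σ; _×_; _,_; proj₁; proj₂; ∃-syntax)
open import Data.Rational as ℚ using (ℚ; _<_; _≤_; _-_; 1ℚ; _/_; toℚᵘ)
import Data.Rational.Properties as ℚ
open import Data.Rational.Unnormalised as ℚᵘ using (mkℚᵘ; *≤*; *<*)
import Data.Rational.Unnormalised.Properties as ℚᵘ
open import Data.Vec using (Vec; []; _∷_; zipWith; replicate)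
open import Data.Vec.Relation.Binary.Pointwise.Inductive as Pointwise using (Pointwise; []; _∷_)
open import Function using (_∘_; id; Inverse; Equivalence; _↔_; _⇔_; mk↔ₛ′; mk⇔)
open import Relation.Binary.Core using (Rel)
open import Relation.Binary.Definitions using (Decidable; Maximum; Minimum)
open import Relation.Binary.Lattice.Definitions using (Supremum; Infimum; Exponential)
open import Relation.Binary.Lattice.Structures using (IsHeytingAlgebra)
open import Relation.Binary.PropositionalEquality
open import Relation.Nullary using (Dec; yes; no; does; ¬_; contradiction)
import Relation.Nullary.Decidable as Dec
open import Relation.Nullary.Construct.Add.Supremum using (_⁺; ⊤⁺; [_])
import Relation.Unary as U

open import Algebra.Properties.CommutativeMonoid.Sum ℕ.+-0-commutativeMonoid
  using (sum; sum-syntax; sum-cong-≗; ∑-distrib-+; sum-replicate-zero)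

open import Defs

𝟙 : ∀ {p} {P : Set p} → Dec P → ℕ
𝟙 P? = if does P? then 1 else 0

∑-mono-≤ : ∀ {n} {f g : Fin n → ℕ} → (∀ i → f i ℕ.≤ g i) → ∑[ i < n ] f i ℕ.≤ ∑[ i < n ] g i
∑-mono-≤ {zero}  _   = z≤n
∑-mono-≤ {suc n} f≤g = ℕ.+-mono-≤ (f≤g zero) (∑-mono-≤ (f≤g ∘ suc))

∑-const : ∀ n c → ∑[ i < n ] c ≡ n * c
∑-const zero    c = refl
∑-const (suc n) c = cong (_+_ c) (∑-const n c)

∑-splitAt : ∀ m {n} (f : Fin (m + n) → ℕ) →
            ∑[ i < m + n ] f i ≡ ∑[ i < m ] f (i ↑ˡ n) + ∑[ j < n ] f (m ↑ʳ j)
∑-splitAt zero    f = refl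
∑-splitAt (suc m) f = trans (cong (_+_ (f zero)) (∑-splitAt m (f ∘ suc))) (sym (ℕ.+-assoc (f zero) _ _))

∑-combine : ∀ m {n} (f : Fin (m * n) → ℕ) →
            ∑[ i < m * n ] f i ≡ ∑[ a < m ] ∑[ b < n ] f (combine a b)
∑-combine zero        f = refl
∑-combine (suc m) {n} f =
  trans (∑-splitAt n f) (cong (_+_ (∑[ b < n ] f (b ↑ˡ m * n))) (∑-combine m (f ∘ (n ↑ʳ_))))

∑∑-cover : ∀ {m n} (f g : Fin m → Fin n → ℕ) → (∀ i j → 1 ℕ.≤ f i j + g i j) →
           m * n ℕ.≤ ∑[ i < m ] ∑[ j < n ] f i j + ∑[ i < m ] ∑[ j < n ] g i j
∑∑-cover {m} {n} f g covered = begin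
  m * n                                             ≡⟨ ∑-const m n ⟨
  ∑[ i < m ] n
    ≡⟨ sum-cong-≗ {m} {λ _ → ∑[ j < n ] 1} (λ _ → trans (∑-const n 1) (ℕ.*-identityʳ n)) ⟨
  ∑[ i < m ] ∑[ j < n ] 1                           ≤⟨ ∑-mono-≤ (∑-mono-≤ ∘ covered) ⟩
  ∑[ i < m ] ∑[ j < n ] (f i j + g i j)             ≡⟨ sum-cong-≗ (λ i → ∑-distrib-+ (f i) (g i)) ⟩
  ∑[ i < m ] (∑[ j < n ] f i j + ∑[ j < n ] g i j)
    ≡⟨ ∑-distrib-+ (λ i → ∑[ j < n ] f i j) (λ i → ∑[ j < n ] g i j) ⟩
  ∑[ i < m ] ∑[ j < n ] f i j + ∑[ i < m ] ∑[ j < n ] g i j ∎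
  where open ℕ.≤-Reasoning

module _ {a p} {A : Set a} {P : U.Pred A p} (P? : U.Decidable P) where

  length-filter-tabulate : ∀ {n} (f : Fin n → A) →
                           length (filter P? (tabulate f)) ≡ ∑[ i < n ] 𝟙 (P? (f i))
  length-filter-tabulate {zero}  f = refl
  length-filter-tabulate {suc n} f with does (P? (f zero))
  ... | true  = cong suc (length-filter-tabulate (f ∘ suc))
  ... | false = length-filter-tabulate (f ∘ suc)

module _ {a b p} {A : Set a} {B : Set b} {P : U.Pred (A × B) p} (P? : U.Decidable P) where

  length-filter-cartesianProduct :
    ∀ {m n} (f : Fin m → A) (g : Fin n → B) →
    length (filter P? (cartesianProduct (tabulate f) (tabulate g))) ≡
    ∑[ i < m ] ∑[ j < n ] 𝟙 (P? (f i , g j))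
  length-filter-cartesianProduct {zero}  f g = refl
  length-filter-cartesianProduct {suc m} f g = begin
    length (filter P? (row ++ rest))                  ≡⟨ cong length (filter-++ P? row rest) ⟩
    length (filter P? row ++ filter P? rest)          ≡⟨ length-++ (filter P? row) ⟩
    length (filter P? row) + length (filter P? rest)
      ≡⟨ cong₂ _+_ (trans (cong (length ∘ filter P?) (map-tabulate g (f zero ,_)))
                          (length-filter-tabulate P? ((f zero ,_) ∘ g)))
                   (length-filter-cartesianProduct (f ∘ suc) g) ⟩
    ∑[ i < suc m ] ∑[ j < _ ] 𝟙 (P? (f i , g j))       ∎
    where
    open ≡-Reasoning
    row  = map (f zero ,_) (tabulate g)
    rest = cartesianProduct (tabulate (f ∘ suc)) (tabulate g)

length-cartesianProduct : ∀ {a b} {A : Set a} {B : Set b} (xs : List A) (ys : List B) →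
                          length (cartesianProduct xs ys) ≡ length xs * length ys
length-cartesianProduct []       ys = refl
length-cartesianProduct (x ∷ xs) ys = begin
  length (map (x ,_) ys ++ cartesianProduct xs ys)          ≡⟨ length-++ (map (x ,_) ys) ⟩
  length (map (x ,_) ys) + length (cartesianProduct xs ys)
    ≡⟨ cong₂ _+_ (length-map (x ,_) ys) (length-cartesianProduct xs ys) ⟩
  length ys + length xs * length ys                         ∎
  where open ≡-Reasoning

_⇒_ : Op₂ Bool
x ⇒ y = not x ∨ y

⇒≡¬∨ : ∀ x y → x ⇒ y ≡ (x ⇒ false) ∨ y
⇒≡¬∨ false y = refl
⇒≡¬∨ true  y = refl

Bool-isHeytingAlgebra : IsHeytingAlgebra _≡_ Bool._≤_ _∨_ _∧_ _⇒_ true false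
Bool-isHeytingAlgebra = record
  { isBoundedLattice = record
    { isLattice = record
      { isPartialOrder = Bool.≤-isPartialOrder
      ; supremum       = supremum
      ; infimum        = infimum
      }
    ; maximum = Bool.≤-maximum
    ; minimum = Bool.≤-minimum
    }
  ; exponential = exponential
  }
  where
  supremum : Supremum Bool._≤_ _∨_
  supremum false y = Bool.≤-minimum y , b≤b , λ _ _ y≤z → y≤z
  supremum true  y = b≤b , Bool.≤-maximum y , λ _ x≤z _ → x≤z

  infimum : Infimum Bool._≤_ _∧_
  infimum false y = b≤b , Bool.≤-minimum y , λ _ z≤x _ → z≤x
  infimum true  y = Bool.≤-maximum y , b≤b , λ _ _ z≤y → z≤y

  exponential : Exponential Bool._≤_ _∧_ _⇒_
  exponential false x     y = (λ _ → Bool.≤-minimum _) , (λ _ → Bool.≤-minimum y)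
  exponential true  false y = (λ _ → b≤b) , (λ _ → Bool.≤-minimum y)
  exponential true  true  y = id , id

module _ {a ℓ} {A : Set a} {_≤_ : Rel A ℓ} {_∨_ _∧_ _⇨_ : Op₂ A} {⊤ ⊥ : A}
         (isHA : IsHeytingAlgebra _≡_ _≤_ _∨_ _∧_ _⇨_ ⊤ ⊥) where

  private module A = IsHeytingAlgebra isHA

  Vec-isHeytingAlgebra : ∀ n → IsHeytingAlgebra _≡_ (Pointwise _≤_)
    (zipWith _∨_) (zipWith _∧_) (zipWith _⇨_) (replicate n ⊤) (replicate n ⊥)
  Vec-isHeytingAlgebra n = record
    { isBoundedLattice = record
      { isLattice = record
        { isPartialOrder = record
          { isPreorder = record
            { isEquivalence = isEquivalence
            ; reflexive     = λ { refl → Pointwise.refl A.refl }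
            ; trans         = Pointwise.trans A.trans
            }
          ; antisym = antisym
          }
        ; supremum = supremum
        ; infimum  = infimum
        }
      ; maximum = maximum
      ; minimum = minimum
      }
    ; exponential = exponential
    }
    where
    antisym : ∀ {m} {xs ys : Vec A m} → Pointwise _≤_ xs ys → Pointwise _≤_ ys xs → xs ≡ ys
    antisym []       []       = refl
    antisym (p ∷ ps) (q ∷ qs) = cong₂ _∷_ (A.antisym p q) (antisym ps qs)

    supremum : ∀ {m} → Supremum (Pointwise _≤_ {m}) (zipWith _∨_)
    supremum []       []       = [] , [] , λ { [] [] [] → [] }
    supremum (x ∷ xs) (y ∷ ys) =
      let x≤ , y≤ , least = A.supremum x y ; xs≤ , ys≤ , leasts = supremum xs ys
      in x≤ ∷ xs≤ , y≤ ∷ ys≤ , λ { (z ∷ zs) (p ∷ ps) (q ∷ qs) → least z p q ∷ leasts zs ps qs }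

    infimum : ∀ {m} → Infimum (Pointwise _≤_ {m}) (zipWith _∧_)
    infimum []       []       = [] , [] , λ { [] [] [] → [] }
    infimum (x ∷ xs) (y ∷ ys) =
      let ≤x , ≤y , greatest = A.infimum x y ; ≤xs , ≤ys , greatests = infimum xs ys
      in ≤x ∷ ≤xs , ≤y ∷ ≤ys , λ { (z ∷ zs) (p ∷ ps) (q ∷ qs) → greatest z p q ∷ greatests zs ps qs }

    maximum : ∀ {m} → Maximum (Pointwise _≤_) (replicate m ⊤)
    maximum []       = []
    maximum (x ∷ xs) = A.maximum x ∷ maximum xs

    minimum : ∀ {m} → Minimum (Pointwise _≤_) (replicate m ⊥)
    minimum []       = []
    minimum (x ∷ xs) = A.minimum x ∷ minimum xs

    exponential : ∀ {m} → Exponential (Pointwise _≤_ {m}) (zipWith _∧_) (zipWith _⇨_)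
    exponential []       []       []       = (λ _ → []) , (λ _ → [])
    exponential (w ∷ ws) (x ∷ xs) (y ∷ ys) =
      let curry , uncurry = A.exponential w x y ; currys , uncurrys = exponential ws xs ys
      in (λ { (p ∷ ps) → curry p ∷ currys ps }) , (λ { (p ∷ ps) → uncurry p ∷ uncurrys ps })

  zipWith-⇨≡¬∨ : (∀ x y → x ⇨ y ≡ (x ⇨ ⊥) ∨ y) →
                 ∀ {n} (xs ys : Vec A n) →
                 zipWith _⇨_ xs ys ≡ zipWith _∨_ (zipWith _⇨_ xs (replicate n ⊥)) ys
  zipWith-⇨≡¬∨ ⇨≡¬∨ []       []       = refl
  zipWith-⇨≡¬∨ ⇨≡¬∨ (x ∷ xs) (y ∷ ys) = cong₂ _∷_ (⇨≡¬∨ x y) (zipWith-⇨≡¬∨ ⇨≡¬∨ xs ys)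

_≤ᵇ?_ : ∀ {k} (u v : Vec Bool k) → Dec (Pointwise Bool._≤_ u v)
_≤ᵇ?_ = Pointwise.decidable Bool._≤?_

-- Adjoining a new top

module AddTop {a ℓ} {A : Set a} {_≤_ : Rel A ℓ} {_∨_ _∧_ _⇨_ : Op₂ A} {⊤ ⊥ : A}
              (isHA : IsHeytingAlgebra _≡_ _≤_ _∨_ _∧_ _⇨_ ⊤ ⊥) (_≤?_ : Decidable _≤_) where

  private module A = IsHeytingAlgebra isHA
  open import Relation.Binary.Construct.Add.Supremum.NonStrict _≤_ public
    using (_≤⁺_; [_]; _≤⊤⁺; ≤⁺-isPartialOrder-≡; ≤⁺-maximum)

  infixr 7 _∧⁺_
  infixr 6 _∨⁺_
  infixr 5 _⇨⁺_

  _∨⁺_ : Op₂ (A ⁺)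
  ⊤⁺    ∨⁺ _     = ⊤⁺
  [ x ] ∨⁺ ⊤⁺    = ⊤⁺
  [ x ] ∨⁺ [ y ] = [ x ∨ y ]

  _∧⁺_ : Op₂ (A ⁺)
  ⊤⁺    ∧⁺ y     = y
  [ x ] ∧⁺ ⊤⁺    = [ x ]
  [ x ] ∧⁺ [ y ] = [ x ∧ y ]

  _⇨⁺_ : Op₂ (A ⁺)
  _     ⇨⁺ ⊤⁺    = ⊤⁺
  ⊤⁺    ⇨⁺ [ y ] = [ y ]
  [ x ] ⇨⁺ [ y ] with x ≤? y
  ... | yes _ = ⊤⁺
  ... | no  _ = [ x ⇨ y ]

  isHeytingAlgebra⁺ : IsHeytingAlgebra _≡_ _≤⁺_ _∨⁺_ _∧⁺_ _⇨⁺_ ⊤⁺ [ ⊥ ]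
  isHeytingAlgebra⁺ = record
    { isBoundedLattice = record
      { isLattice = record
        { isPartialOrder = ≤⁺-isPartialOrder-≡ A.isPartialOrder
        ; supremum       = supremum
        ; infimum        = infimum
        }
      ; maximum = ≤⁺-maximum
      ; minimum = minimum
      }
    ; exponential = exponential
    }
    where
    supremum : Supremum _≤⁺_ _∨⁺_
    supremum ⊤⁺    y     = (⊤⁺ ≤⊤⁺) , (y ≤⊤⁺) , λ _ ⊤≤z _ → ⊤≤z
    supremum [ x ] ⊤⁺    = ([ x ] ≤⊤⁺) , (⊤⁺ ≤⊤⁺) , λ _ _ ⊤≤z → ⊤≤z
    supremum [ x ] [ y ] =
      let x≤ , y≤ , least = A.supremum x y
      in [ x≤ ] , [ y≤ ] , λ { ⊤⁺ _ _ → [ x ∨ y ] ≤⊤⁺ ; [ z ] [ p ] [ q ] → [ least z p q ] }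

    infimum : Infimum _≤⁺_ _∧⁺_
    infimum ⊤⁺    ⊤⁺    = (⊤⁺ ≤⊤⁺) , (⊤⁺ ≤⊤⁺) , λ z _ _ → z ≤⊤⁺
    infimum ⊤⁺    [ y ] = ([ y ] ≤⊤⁺) , [ A.refl ] , λ _ _ z≤y → z≤y
    infimum [ x ] ⊤⁺    = [ A.refl ] , ([ x ] ≤⊤⁺) , λ _ z≤x _ → z≤x
    infimum [ x ] [ y ] =
      let ≤x , ≤y , greatest = A.infimum x y
      in [ ≤x ] , [ ≤y ] , λ { ⊤⁺ () _ ; [ z ] [ p ] [ q ] → [ greatest z p q ] }

    minimum : Minimum _≤⁺_ [ ⊥ ]
    minimum ⊤⁺    = [ ⊥ ] ≤⊤⁺
    minimum [ x ] = [ A.minimum x ]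

    exponential : Exponential _≤⁺_ _∧⁺_ _⇨⁺_
    exponential w     x     ⊤⁺    = (λ _ → w ≤⊤⁺) , (λ _ → (w ∧⁺ x) ≤⊤⁺)
    exponential ⊤⁺    ⊤⁺    [ y ] = id , id
    exponential [ w ] ⊤⁺    [ y ] = id , id
    exponential w     [ x ] [ y ] with x ≤? y
    ... | yes x≤y = (λ _ → w ≤⊤⁺) , (λ _ → ∧⁺x≤y w)
      where
      ∧⁺x≤y : ∀ w → (w ∧⁺ [ x ]) ≤⁺ [ y ]
      ∧⁺x≤y ⊤⁺    = [ x≤y ]
      ∧⁺x≤y [ w ] = [ A.trans (proj₁ (proj₂ (A.infimum w x))) x≤y ]
    ... | no  x≰y = curry w , uncurry w
      where
      curry : ∀ w → (w ∧⁺ [ x ]) ≤⁺ [ y ] → w ≤⁺ [ x ⇨ y ]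
      curry ⊤⁺    [ x≤y ] = contradiction x≤y x≰y
      curry [ w ] [ p ]   = [ A.transpose-⇨ p ]

      uncurry : ∀ w → w ≤⁺ [ x ⇨ y ] → (w ∧⁺ [ x ]) ≤⁺ [ y ]
      uncurry [ w ] [ p ] = [ A.transpose-∧ p ]

  data _≤ᴬ_ : Rel (A ⁺) (a ⊔ ℓ) where
    [_] : ∀ {x y} → x ≤ y → [ x ] ≤ᴬ [ y ]

  _≤ᴬ?_ : Decidable _≤ᴬ_
  ⊤⁺    ≤ᴬ? _     = no λ ()
  [ x ] ≤ᴬ? ⊤⁺    = no λ ()
  [ x ] ≤ᴬ? [ y ] = Dec.map′ [_] (λ { [ p ] → p }) (x ≤? y)

  ⇨⁺≡¬∨⁺ : (∀ x y → x ⇨ y ≡ (x ⇨ ⊥) ∨ y) →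
           ∀ x y → ¬ x ≤ᴬ y → x ⇨⁺ y ≡ (x ⇨⁺ [ ⊥ ]) ∨⁺ y
  ⇨⁺≡¬∨⁺ _ ⊤⁺ ⊤⁺ _ = refl
  ⇨⁺≡¬∨⁺ _ [ x ] ⊤⁺ _ with x ≤? ⊥
  ... | yes _ = refl
  ... | no  _ = refl
  ⇨⁺≡¬∨⁺ _ ⊤⁺ [ y ] _ = cong [_] (A.antisym y≤⊥∨y ⊥∨y≤y)
    where
    y≤⊥∨y = proj₁ (proj₂ (A.supremum ⊥ y))
    ⊥∨y≤y = proj₂ (proj₂ (A.supremum ⊥ y)) y (A.minimum y) A.refl
  ⇨⁺≡¬∨⁺ ⇨≡¬∨ [ x ] [ y ] x≰ᴬy with x ≤? y | x ≤? ⊥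
  ... | yes x≤y | _       = contradiction [ x≤y ] x≰ᴬy
  ... | no  x≰y | yes x≤⊥ = contradiction (A.trans x≤⊥ (A.minimum y)) x≰y
  ... | no  _   | no  _   = cong [_] (⇨≡¬∨ x y)

  ⇨⁺≢¬∨⁺ : ∀ {x y} → x ≤ y → ¬ x ≤ ⊥ → [ x ] ⇨⁺ [ y ] ≢ ([ x ] ⇨⁺ [ ⊥ ]) ∨⁺ [ y ]
  ⇨⁺≢¬∨⁺ {x} {y} x≤y x≰⊥ with x ≤? y | x ≤? ⊥
  ... | no  x≰y | _       = contradiction x≤y x≰y
  ... | yes _   | yes x≤⊥ = contradiction x≤⊥ x≰⊥
  ... | yes _   | no  _   = λ ()

module _ {n} {A : Set} {_≤ᴬ_ : Rel A 0ℓ} {_∨ᴬ_ _∧ᴬ_ _⇨_ : Op₂ A} {⊤ ⊥ : A}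
         (Fin↔A : Fin n ↔ A) (isHA : IsHeytingAlgebra _≡_ _≤ᴬ_ _∨ᴬ_ _∧ᴬ_ _⇨_ ⊤ ⊥) where

  open Inverse Fin↔A using (to; from; strictlyInverseˡ; strictlyInverseʳ)
  private module A = IsHeytingAlgebra isHA

  pullback : FiniteHeytingAlgebra
  pullback = record
    { size = n
    ; _≤_  = _≤ᶠ_
    ; _∨_  = λ i j → from (to i ∨ᴬ to j)
    ; _∧_  = λ i j → from (to i ∧ᴬ to j)
    ; _⇨_  = λ i j → from (to i ⇨ to j)
    ; ⊤    = from ⊤
    ; ⊥    = from ⊥
    ; isHeytingAlgebra = record
      { isBoundedLattice = record
        { isLattice = record
          { isPartialOrder = record
            { isPreorder = record
              { isEquivalence = isEquivalence
              ; reflexive     = λ { refl → A.refl }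
              ; trans         = A.trans
              }
            ; antisym = λ {i} {j} i≤j j≤i →
                trans (sym (strictlyInverseʳ i)) (trans (cong from (A.antisym i≤j j≤i)) (strictlyInverseʳ j))
            }
          ; supremum = supremum
          ; infimum  = infimum
          }
        ; maximum = maximum
        ; minimum = minimum
        }
      ; exponential = exponential
      }
    }
    where
    _≤ᶠ_ : Rel (Fin n) 0ℓ
    i ≤ᶠ j = to i ≤ᴬ to j

    supremum : Supremum _≤ᶠ_ (λ i j → from (to i ∨ᴬ to j))
    supremum i j rewrite strictlyInverseˡ (to i ∨ᴬ to j) =
      let i≤ , j≤ , least = A.supremum (to i) (to j) in i≤ , j≤ , λ k → least (to k)

    infimum : Infimum _≤ᶠ_ (λ i j → from (to i ∧ᴬ to j))
    infimum i j rewrite strictlyInverseˡ (to i ∧ᴬ to j) =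
      let ≤i , ≤j , greatest = A.infimum (to i) (to j) in ≤i , ≤j , λ k → greatest (to k)

    maximum : Maximum _≤ᶠ_ (from ⊤)
    maximum i rewrite strictlyInverseˡ ⊤ = A.maximum (to i)

    minimum : Minimum _≤ᶠ_ (from ⊥)
    minimum i rewrite strictlyInverseˡ ⊥ = A.minimum (to i)

    exponential : Exponential _≤ᶠ_ (λ i j → from (to i ∧ᴬ to j)) (λ i j → from (to i ⇨ to j))
    exponential h i j rewrite strictlyInverseˡ (to h ∧ᴬ to i) | strictlyInverseˡ (to i ⇨ to j) =
      A.exponential (to h) (to i) (to j)

  pullback-⇨≡¬∨ : let open FiniteHeytingAlgebra pullback using ()
                        renaming (_⇨_ to _⇨ᶠ_; _∨_ to _∨ᶠ_; ¬_ to ¬ᶠ_) in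
                  ∀ i j → (i ⇨ᶠ j ≡ (¬ᶠ i) ∨ᶠ j) ⇔ (to i ⇨ to j ≡ (to i ⇨ ⊥) ∨ᴬ to j)
  pullback-⇨≡¬∨ i j rewrite strictlyInverseˡ ⊥ | strictlyInverseˡ (to i ⇨ ⊥) =
    mk⇔ from-injective (cong from)
    where
    from-injective : ∀ {x y} → from x ≡ from y → x ≡ y
    from-injective {x} {y} eq = trans (sym (strictlyInverseˡ x)) (trans (cong to eq) (strictlyInverseˡ y))

suc↔⁺ : ∀ {a} {A : Set a} {n} → Fin n ↔ A → Fin (suc n) ↔ A ⁺
suc↔⁺ {A = A} {n} Fin↔A = mk↔ₛ′ to⁺ from⁺ to∘from from∘to
  where
  open Inverse Fin↔A
  to⁺ : Fin (suc n) → A ⁺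
  to⁺ zero    = ⊤⁺
  to⁺ (suc i) = [ to i ]
  from⁺ : A ⁺ → Fin (suc n)
  from⁺ ⊤⁺    = zero
  from⁺ [ x ] = suc (from x)
  to∘from : ∀ x → to⁺ (from⁺ x) ≡ x
  to∘from ⊤⁺    = refl
  to∘from [ x ] = cong [_] (strictlyInverseˡ x)
  from∘to : ∀ i → from⁺ (to⁺ i) ≡ i
  from∘to zero    = refl
  from∘to (suc i) = cong suc (strictlyInverseʳ i)

module _ where
  open Inverse 2↔Bool using (strictlyInverseˡ; strictlyInverseʳ) renaming (to to toBool; from to fromBool)

  bits : ∀ k → Fin (2 ^ k) → Vec Bool k
  bits zero    _ = []
  bits (suc k) i = let b , j = remQuot (2 ^ k) i in toBool b ∷ bits k j

  fromBits : ∀ {k} → Vec Bool k → Fin (2 ^ k)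
  fromBits []      = zero
  fromBits (x ∷ v) = combine (fromBool x) (fromBits v)

  bits-combine : ∀ k (b : Fin 2) (i : Fin (2 ^ k)) → bits (suc k) (combine b i) ≡ toBool b ∷ bits k i
  bits-combine k b i = cong (λ (b , j) → toBool b ∷ bits k j) (remQuot-combine {k = 2 ^ k} b i)

  bits↔ : ∀ k → Fin (2 ^ k) ↔ Vec Bool k
  bits↔ k = mk↔ₛ′ (bits k) fromBits bits∘fromBits (fromBits∘bits k)
    where
    bits∘fromBits : ∀ {k} (v : Vec Bool k) → bits k (fromBits v) ≡ v
    bits∘fromBits         []      = refl
    bits∘fromBits {suc k} (x ∷ v) = trans (bits-combine k (fromBool x) (fromBits v))
                                          (cong₂ _∷_ (strictlyInverseˡ x) (bits∘fromBits v))
    fromBits∘bits : ∀ k (i : Fin (2 ^ k)) → fromBits (bits k i) ≡ i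
    fromBits∘bits zero    zero = refl
    fromBits∘bits (suc k) i    = let b , j = remQuot (2 ^ k) i in
      trans (cong₂ combine (strictlyInverseʳ b) (fromBits∘bits k j)) (combine-remQuot {2} (2 ^ k) i)

  ∑-bits : ∀ k (g : Vec Bool (suc k) → ℕ) →
           ∑[ i < 2 ^ suc k ] g (bits (suc k) i) ≡
           ∑[ i < 2 ^ k ] g (false ∷ bits k i) + ∑[ i < 2 ^ k ] g (true ∷ bits k i)
  ∑-bits k g = begin
    ∑[ i < 2 ^ suc k ] g (bits (suc k) i)                     ≡⟨ ∑-combine 2 {2 ^ k} (g ∘ bits (suc k)) ⟩
    ∑[ b < 2 ] ∑[ i < 2 ^ k ] g (bits (suc k) (combine b i))
      ≡⟨ cong₂ _+_ (sum-cong-≗ (cong g ∘ bits-combine k zero))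
                   (trans (ℕ.+-identityʳ _) (sum-cong-≗ (cong g ∘ bits-combine k (suc zero)))) ⟩
    ∑[ i < 2 ^ k ] g (false ∷ bits k i) + ∑[ i < 2 ^ k ] g (true ∷ bits k i) ∎
    where open ≡-Reasoning

comparable-bits : ∀ k → ∑[ i < 2 ^ k ] ∑[ j < 2 ^ k ] 𝟙 (bits k i ≤ᵇ? bits k j) ≡ 3 ^ k
comparable-bits zero    = refl
comparable-bits (suc k) = begin
  ∑[ i < 2 ^ suc k ] row (bits (suc k) i)                             ≡⟨ ∑-bits k row ⟩
  ∑[ i < 2 ^ k ] row (false ∷ bits k i) + ∑[ i < 2 ^ k ] row (true ∷ bits k i)
    ≡⟨ cong₂ _+_ (sum-cong-≗ (∑-bits k ∘ rowOf false)) (sum-cong-≗ (∑-bits k ∘ rowOf true)) ⟩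
  ∑[ i < 2 ^ k ] (C i + C i) + ∑[ i < 2 ^ k ] (∑[ j < 2 ^ k ] 0 + C i)
    ≡⟨ cong₂ _+_ (∑-distrib-+ C C) (sum-cong-≗ (λ i → cong (_+ C i) (sum-replicate-zero (2 ^ k)))) ⟩
  (∑[ i < 2 ^ k ] C i + ∑[ i < 2 ^ k ] C i) + ∑[ i < 2 ^ k ] C i
    ≡⟨ cong (λ c → (c + c) + c) (comparable-bits k) ⟩
  (3 ^ k + 3 ^ k) + 3 ^ k                                             ≡⟨ ℕ.+-assoc (3 ^ k) (3 ^ k) (3 ^ k) ⟩
  3 ^ k + (3 ^ k + 3 ^ k)
    ≡⟨ cong (λ c → 3 ^ k + (3 ^ k + c)) (ℕ.+-identityʳ (3 ^ k)) ⟨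
  3 ^ suc k                                                           ∎
  where
  open ≡-Reasoning
  row : Vec Bool (suc k) → ℕ
  row u = ∑[ j < 2 ^ suc k ] 𝟙 (u ≤ᵇ? bits (suc k) j)
  rowOf : Bool → Fin (2 ^ k) → Vec Bool (suc k) → ℕ
  rowOf x i v = 𝟙 ((x ∷ bits k i) ≤ᵇ? v)
  C : Fin (2 ^ k) → ℕ
  C i = ∑[ j < 2 ^ k ] 𝟙 (bits k i ≤ᵇ? bits k j)

-- The algebras 2ᵏ ⊕ 1

module Boolean⊕1 (k : ℕ) = AddTop (Vec-isHeytingAlgebra Bool-isHeytingAlgebra k) _≤ᵇ?_

Fin↔bits⁺ : ∀ k → Fin (suc (2 ^ k)) ↔ (Vec Bool k) ⁺
Fin↔bits⁺ k = suc↔⁺ (bits↔ k)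

boolean⊕1 : ℕ → FiniteHeytingAlgebra
boolean⊕1 k = pullback (Fin↔bits⁺ k) (Boolean⊕1.isHeytingAlgebra⁺ k)

module _ (k : ℕ) where
  open FiniteHeytingAlgebra (boolean⊕1 k) using (size) renaming (_⇨_ to _⇨ᴴ_; _∨_ to _∨ᴴ_; ¬_ to ¬ᴴ_)
  open Boolean⊕1 k
  open Inverse (Fin↔bits⁺ k) using (to; from; strictlyInverseˡ)

  satisfies? : ∀ ((i , j) : Fin size × Fin size) → Dec (i ⇨ᴴ j ≡ (¬ᴴ i) ∨ᴴ j)
  satisfies? (i , j) = (i ⇨ᴴ j) ≟ ((¬ᴴ i) ∨ᴴ j)

  pullback-⇨≡¬∨ᴴ : ∀ i j → (i ⇨ᴴ j ≡ (¬ᴴ i) ∨ᴴ j) ⇔ (to i ⇨⁺ to j ≡ (to i ⇨⁺ [ replicate k false ]) ∨⁺ to j)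
  pullback-⇨≡¬∨ᴴ = pullback-⇨≡¬∨ (Fin↔bits⁺ k) isHeytingAlgebra⁺

  count-satisfying : length (satisfyingPairs (boolean⊕1 k)) ≡ ∑[ i < size ] ∑[ j < size ] 𝟙 (satisfies? (i , j))
  count-satisfying = length-filter-cartesianProduct satisfies? id id

  satisfying-or-comparable : ∀ i j → 1 ℕ.≤ 𝟙 (satisfies? (i , j)) + 𝟙 (to i ≤ᴬ? to j)
  satisfying-or-comparable i j with to i ≤ᴬ? to j | satisfies? (i , j)
  ... | yes _   | _       = ℕ.m≤n+m 1 _
  ... | no  _   | yes _   = s≤s z≤n
  ... | no  i≰j | no ¬sat = contradiction
    (Equivalence.from (pullback-⇨≡¬∨ᴴ i j) (⇨⁺≡¬∨⁺ (zipWith-⇨≡¬∨ Bool-isHeytingAlgebra ⇒≡¬∨) (to i) (to j) i≰j))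
    ¬sat

  -- Row and column ⊤⁺ contribute nothing; what remains is the count over 2ᵏ.
  count-comparable : ∑[ i < size ] ∑[ j < size ] 𝟙 (to i ≤ᴬ? to j) ≡ 3 ^ k
  count-comparable =
    trans (cong (_+ ∑[ i < 2 ^ k ] ∑[ j < 2 ^ k ] 𝟙 (bits k i ≤ᵇ? bits k j)) (sum-replicate-zero size))
          (comparable-bits k)

  few-failures : size * size ℕ.≤ length (satisfyingPairs (boolean⊕1 k)) + 3 ^ k
  few-failures = subst₂ (λ N C → size * size ℕ.≤ N + C) (sym count-satisfying) count-comparable
    (∑∑-cover (λ i j → 𝟙 (satisfies? (i , j))) (λ i j → 𝟙 (to i ≤ᴬ? to j)) satisfying-or-comparable)

  top-pair-fails : ¬ Pointwise Bool._≤_ (replicate k true) (replicate k false) →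
                   length (satisfyingPairs (boolean⊕1 k)) ℕ.< size * size
  top-pair-fails ⊤≰⊥ = begin-strict
    length (satisfyingPairs (boolean⊕1 k))       <⟨ filter-notAll satisfies? pairs (lose i₀i₀∈pairs i₀i₀-fails) ⟩
    length pairs                                 ≡⟨ length-cartesianProduct (allFin size) (allFin size) ⟩
    length (allFin size) * length (allFin size)  ≡⟨ cong₂ _*_ (length-tabulate {n = size} id) (length-tabulate {n = size} id) ⟩
    size * size                                  ∎
    where
    open ℕ.≤-Reasoning
    pairs = cartesianProduct (allFin size) (allFin size)
    ⊤ = replicate k true
    i₀ = from [ ⊤ ]
    i₀i₀∈pairs = ∈-cartesianProduct⁺ (∈-allFin i₀) (∈-allFin i₀)
    i₀i₀-fails : ¬ (i₀ ⇨ᴴ i₀ ≡ (¬ᴴ i₀) ∨ᴴ i₀)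
    i₀i₀-fails sat = ⇨⁺≢¬∨⁺ (Pointwise.refl b≤b) ⊤≰⊥
      (subst (λ x → x ⇨⁺ x ≡ (x ⇨⁺ [ replicate k false ]) ∨⁺ x) (strictlyInverseˡ [ ⊤ ])
             (Equivalence.to (pullback-⇨≡¬∨ᴴ i₀ i₀) sat))

-- Rational bounds

toℚᵘ-/ : ∀ a d → toℚᵘ (+ a / suc d) ℚᵘ.≃ mkℚᵘ (+ a) d
toℚᵘ-/ a d = ℚ.toℚᵘ-fromℚᵘ (mkℚᵘ (+ a) d)

/<1 : ∀ {a m} .{{_ : ℕ.NonZero m}} → a ℕ.< m → + a / m < 1ℚ
/<1 {a} {suc d} a<m = ℚ.toℚᵘ-cancel-< (ℚᵘ.<-respˡ-≃ (ℚᵘ.≃-sym (toℚᵘ-/ a d))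
  (*<* (subst₂ ℤ._<_ (sym (ℤ.*-identityʳ (+ a))) (sym (ℤ.*-identityˡ (+ suc d))) (+<+ a<m))))

-- mkℚᵘ n b denotes n / (1 + b), so the denominator 4ᵏ appears as suc b.
toℚᵘ-¾^ : ∀ k → ∃[ b ] suc b ≡ 4 ^ k × toℚᵘ ((+ 3 / 4) ^ℚ k) ℚᵘ.≃ mkℚᵘ (+ 3 ^ k) b
toℚᵘ-¾^ zero    = 0 , refl , ℚᵘ.≃-refl
toℚᵘ-¾^ (suc k) with toℚᵘ-¾^ k
... | b , 1+b≡4^k , ¾^k≃ = b + 3 * suc b , cong (4 *_) 1+b≡4^k ,
  ℚᵘ.≃-trans (ℚ.toℚᵘ-homo-* (+ 3 / 4) ((+ 3 / 4) ^ℚ k))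
    (ℚᵘ.≃-trans (ℚᵘ.*-congˡ {toℚᵘ (+ 3 / 4)} ¾^k≃)
      (ℚᵘ.*≡* (cong (ℤ._* + suc (b + 3 * suc b)) (sym (ℤ.pos-* 3 (3 ^ k))))))

p≤r+q⇒p-q≤r : ∀ {p q r} → p ≤ r ℚ.+ q → p - q ≤ r
p≤r+q⇒p-q≤r {p} {q} {r} p≤r+q = begin
  p - q              ≤⟨ ℚ.+-monoˡ-≤ (ℚ.- q) p≤r+q ⟩
  (r ℚ.+ q) - q      ≡⟨ ℚ.+-assoc r q (ℚ.- q) ⟩
  r ℚ.+ (q - q)      ≡⟨ cong (r ℚ.+_) (ℚ.+-inverseʳ q) ⟩
  r ℚ.+ ℚ.0ℚ         ≡⟨ ℚ.+-identityʳ r ⟩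
  r                  ∎
  where open ℚ.≤-Reasoning

1≤/+ : ∀ {q c b a m} .{{_ : ℕ.NonZero m}} → toℚᵘ q ℚᵘ.≃ mkℚᵘ (+ c) b →
       m * suc b ℕ.≤ a * suc b + c * m → 1ℚ ≤ + a / m ℚ.+ q
1≤/+ {q} {c} {b} {a} {suc d} q≃c/b cross = ℚ.toℚᵘ-cancel-≤ (begin
  toℚᵘ 1ℚ                            ≤⟨ *≤* cross-ℤ ⟩
  mkℚᵘ (+ a) d ℚᵘ.+ mkℚᵘ (+ c) b      ≃⟨ ℚᵘ.+-cong (toℚᵘ-/ a d) q≃c/b ⟨
  toℚᵘ (+ a / suc d) ℚᵘ.+ toℚᵘ q       ≃⟨ ℚ.toℚᵘ-homo-+ (+ a / suc d) q ⟨
  toℚᵘ (+ a / suc d ℚ.+ q)            ∎)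
  where
  open ℚᵘ.≤-Reasoning
  cross-ℤ : + 1 ℤ.* + (suc d * suc b) ℤ.≤ (+ a ℤ.* + suc b ℤ.+ + c ℤ.* + suc d) ℤ.* + 1
  cross-ℤ = subst₂ ℤ._≤_ (sym (ℤ.*-identityˡ _)) (sym (ℤ.*-identityʳ _))
    (subst (+ (suc d * suc b) ℤ.≤_)
           (trans (ℤ.pos-+ (a * suc b) (c * suc d)) (cong₂ ℤ._+_ (ℤ.pos-* a (suc b)) (ℤ.pos-* c (suc d))))
           (+≤+ cross))

cross-multiplied : ∀ {a c b d} → b ℕ.≤ d → d ℕ.≤ a + c → d * b ℕ.≤ a * b + c * d
cross-multiplied {a} {c} {b} {d} b≤d d≤a+c = begin
  d * b          ≤⟨ ℕ.*-monoˡ-≤ b d≤a+c ⟩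
  (a + c) * b    ≡⟨ ℕ.*-distribʳ-+ b a c ⟩
  a * b + c * b  ≤⟨ ℕ.+-monoʳ-≤ (a * b) (ℕ.*-monoʳ-≤ c b≤d) ⟩
  a * b + c * d  ∎
  where open ℕ.≤-Reasoning

2^k*2^k≡4^k : ∀ k → 2 ^ k * 2 ^ k ≡ 4 ^ k
2^k*2^k≡4^k zero    = refl
2^k*2^k≡4^k (suc k) = trans (double-squared (2 ^ k)) (cong (4 *_) (2^k*2^k≡4^k k))
  where
  double-squared : ∀ x → (2 * x) * (2 * x) ≡ 4 * (x * x)
  double-squared = solve-∀

4^k≤[1+2^k]² : ∀ k → 4 ^ k ℕ.≤ suc (2 ^ k) * suc (2 ^ k)
4^k≤[1+2^k]² k = subst (ℕ._≤ suc (2 ^ k) * suc (2 ^ k)) (2^k*2^k≡4^k k)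
                       (ℕ.*-mono-≤ (ℕ.n≤1+n (2 ^ k)) (ℕ.n≤1+n (2 ^ k)))

ds<1 : ∀ k → ds-impl-negor (boolean⊕1 (suc k)) < 1ℚ
ds<1 k = /<1 (top-pair-fails (suc k) λ { (() ∷ _) })

1-¾^≤ds : ∀ k → 1ℚ - (+ 3 / 4) ^ℚ k ≤ ds-impl-negor (boolean⊕1 k)
1-¾^≤ds k =
  let b , 1+b≡4^k , ¾^k≃ = toℚᵘ-¾^ k
  in p≤r+q⇒p-q≤r (1≤/+ {a = N} {m = suc (2 ^ k) * suc (2 ^ k)} ¾^k≃
                   (cross-multiplied {a = N} {c = 3 ^ k}
                      (ℕ.≤-trans (ℕ.≤-reflexive 1+b≡4^k) (4^k≤[1+2^k]² k)) (few-failures k)))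
  where N = length (satisfyingPairs (boolean⊕1 k))

theorem3p15 : Σ (ℕ → FiniteHeytingAlgebra) λ H → ∀ n → (ds-impl-negor (H n) < 1ℚ) × ((1ℚ - ((+ 3 / 4) ^ℚ suc n)) ≤ ds-impl-negor (H n))
theorem3p15 = boolean⊕1 ∘ suc , λ n → ds<1 n , 1-¾^≤ds (suc n)
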